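{- Let $\alpha$ be an irrational point of $\mathbb{R}/\mathbb{Z}$ and let $E_n=E_n(\alpha)$, $n=1,2,\dots$, be as defined in the context. Let $\beta\in\mathbb{Q}/\mathbb{Z}$. Then $f_\beta(\alpha)\neq 0$ if and only if $\beta\in E_n$ for some $n\ge 1$. Moreover, if $\beta\in E_n$ then $$f_\beta(\alpha)=(-1)^{n-1}q_{n-1}(\alpha).$$
   Context: Heights and Farey sets. Every $\beta\in\mathbb{Q}/\mathbb{Z}$ can be written $\beta=a/q$ with $q\ge1$ and $\gcd(a,q)=1$. Its height is $h(\beta)=q$, the order of $\beta$ in $\mathbb{Q}/\mathbb{Z}$. For $Q\ge1$ put $\mathcal{F}_Q=\{\beta\in\mathbb{Q}/\mathbb{Z}:h(\beta)\le Q\}$. Arcs. For distinct $a,b\in\mathbb{R}/\mathbb{Z}$ let $I(a,b)=\{a+t \bmod 1: 0<t<d\}$, where $d\in(0,1)$ satisfies $d\equiv b-a \pmod 1$. This is the open arc running in the positive direction from $a$ to $b$; write $\overline{I}(a,b)$ for its closure. The maps $\beta\mapsto\beta',\beta''$. Let $\beta\ne0$ with $h(\beta)=Q$. Then $\beta'$ is the unique point of $\mathcal{F}_Q$ such that $I(\beta',\beta)$ contains no point of $\mathcal{F}_Q$. Likewise $\beta''$ is the unique point of $\mathcal{F}_Q$ such that $I(\beta,\beta'')$ contains no point of $\mathcal{F}_Q$. Sawtooth function: $\psi(x)=x-[x]-\tfrac12$ for $x\notin\mathbb{Z}$ and $\psi(x)=0$ for $x\in\mathbb{Z}$; it is viewed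 as a function on $\mathbb{R}/\mathbb{Z}$. The functions $f_\beta:\mathbb{R}/\mathbb{Z}\to\mathbb{R}$. Put $f_0\equiv1$. For $\beta\neq0$ put $$f_\beta(x)=h(\beta)\psi(x-\beta)-h(\beta')\psi(x-\beta')-h(\beta'')\psi(x-\beta'').$$ Equivalently, $f_\beta=h(\beta')$ on $I(\beta',\beta)$, $f_\beta=-h(\beta'')$ on $I(\beta,\beta'')$, and $f_\beta=0$ outside $\overline{I}(\beta',\beta'')$. Continued fractions. Identify an irrational $\alpha\in\mathbb{R}/\mathbb{Z}$ with its representative in $(0,1)$. Write $\alpha=[0;a_1,a_2,\dots]$ for its simple continued fraction expansion. Set $p_{ -2}=0$, $q_{ -2}=1$, $p_{ -1}=1$, $q_{ -1}=0$, and for $n\ge0$ set $p_n=a_np_{n-1}+p_{n-2}$ and $q_n=a_nq_{n-1}+q_{n-2}$, with $a_0=0$. For $n\ge1$, $$E_n(\alpha)=\left\{\frac{mp_{n-1}+p_{n-2}}{mq_{n-1}+q_{n-2}}:m=1,\dots,a_n\right\},$$ viewed as a subset of $\mathbb{Q}/\mathbb{Z}$. It consists of the convergent $p_n/q_n$ together with the intermediate convergents. -}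

module Defs where

open import Data.Bool using (Bool; true; false; not; _∧_; _∨_; if_then_else_)
open import Data.Nat as ℕ using (ℕ; zero; suc; _∸_)
open import Data.Integer as ℤ using (ℤ; +_; -_; -1ℤ)
open import Data.Rational using (ℚ; _<_; _≤_; 0ℚ; 1ℚ; ↧ₙ_; _/_; _+_)
open import Data.Rational.Properties using (_<?_; _≟_)
open import Data.Product using (Σ; _×_; ∃)
open import Data.Sum using (_⊎_)
open import Relation.Nullary using (¬_; does)
open import Relation.Binary.PropositionalEquality using (_≡_; _≢_)

-- Q/Z : rationals β with 0 ≤ β < 1 (canonical representatives).
-- Points are compared through their value 'val' (a reduced ℚ).

record QZ : Set where
  constructor qz
  field
    val   : ℚ
    nonneg : 0ℚ ≤ val
    lt1    : val < 1ℚ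
open QZ public

h : QZ → ℕ
h β = ↧ₙ (val β)

IsZero : QZ → Set
IsZero β = val β ≡ 0ℚ

-- δ lies in the open arc I(x,y) of R/Z (x ≠ y), all given by their
-- representatives in [0,1):  if x < y it is (x,y); if y < x it is (x,1) ∪ [0,y).
InArc : ℚ → ℚ → ℚ → Set
InArc x y δ = (x < y × x < δ × δ < y) ⊎ (y < x × (x < δ ⊎ δ < y))

-- β' : the point of F_{h β}, distinct from β, with I(β',β) free of F_{h β}
IsPrev : QZ → QZ → Set
IsPrev β γ = (h γ ℕ.≤ h β) × (val γ ≢ val β) ×
             (∀ (δ : QZ) → h δ ℕ.≤ h β → ¬ InArc (val γ) (val β) (val δ))

-- β'' : the point of F_{h β}, distinct from β, with I(β,β'') free of F_{h β}
IsNext : QZ → QZ → Set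
IsNext β γ = (h γ ℕ.≤ h β) × (val γ ≢ val β) ×
             (∀ (δ : QZ) → h δ ℕ.≤ h β → ¬ InArc (val β) (val γ) (val δ))

-- An irrational point α of R/Z, identified with its representative in
-- (0,1), given as a Dedekind cut:  below r ≡ true  iff  r < α.
-- The openness conditions on both sides say α is not rational.

record Irr01 : Set where
  field
    below  : ℚ → Bool
    mono   : ∀ r s → r ≤ s → below s ≡ true → below r ≡ true
    openL  : ∀ r → below r ≡ true  → ∃ λ s → r < s × below s ≡ true
    openU  : ∀ r → below r ≡ false → ∃ λ s → s < r × below s ≡ false
    pos    : below 0ℚ ≡ true
    less1  : below 1ℚ ≡ false
open Irr01 public

αInArc : Irr01 → ℚ → ℚ → Bool
αInArc α x y =
  if does (x <? y)
  then below α x ∧ not (below α y)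
  else below α x ∨ not (below α y)

-- f_β(α), where β' and β'' are supplied (they are only used when β ≠ 0):
-- f_0 = 1;  f_β = h β' on I(β',β), -h β'' on I(β,β''), 0 elsewhere.
-- (α is irrational, so α is never an endpoint of these arcs.)
fAt : Irr01 → (β β' β'' : QZ) → ℤ
fAt α β β' β'' =
  if does (val β ≟ 0ℚ) then + 1
  else if αInArc α (val β') (val β) then + h β'
  else if αInArc α (val β) (val β'') then - (+ h β'')
  else + 0

-- Continued fractions.  a : ℕ → ℕ with a 0 = a₀ = 0, a n = aₙ.
-- Shifted numerators/denominators:  pS a k = p_{k-2},  qS a k = q_{k-2}.

pS : (ℕ → ℕ) → ℕ → ℕ
pS a zero = 0
pS a (suc zero) = 1
pS a (suc (suc n)) = a n ℕ.* pS a (suc n) ℕ.+ pS a n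

qS : (ℕ → ℕ) → ℕ → ℕ
qS a zero = 1
qS a (suc zero) = 0
qS a (suc (suc n)) = a n ℕ.* qS a (suc n) ℕ.+ qS a n

-- the fraction n/d in ℚ (junk value 0 when d = 0; only used with d ≥ 1)
frac : ℕ → ℕ → ℚ
frac n zero = 0ℚ
frac n (suc d) = (+ n) / suc d

evenB : ℕ → Bool
evenB zero = true
evenB (suc n) = not (evenB n)

conv : (ℕ → ℕ) → ℕ → ℚ
conv a n = frac (pS a (suc (suc n))) (qS a (suc (suc n)))

-- α = [0; a₁, a₂, …]: the aₙ (n ≥ 1) are positive integers and α is the
-- limit of the convergents, i.e. (the convergents being alternating with
-- interval lengths → 0) p_n/q_n < α for n even and α < p_n/q_n for n odd.
IsCF : Irr01 → (ℕ → ℕ) → Set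
IsCF α a = (a 0 ≡ 0) × (∀ n → 1 ℕ.≤ a (suc n)) ×
           (∀ n → below α (conv a n) ≡ evenB n)

-- β ∈ E_n(α)  (n ≥ 1):  β ≡ (m p_{n-1} + p_{n-2}) / (m q_{n-1} + q_{n-2})
-- mod 1 for some 1 ≤ m ≤ aₙ.
InE : (ℕ → ℕ) → ℕ → QZ → Set
InE a n β = Σ ℕ λ m → (1 ℕ.≤ m) × (m ℕ.≤ a n) × Σ ℤ λ k →
  frac (m ℕ.* pS a (suc n) ℕ.+ pS a n) (m ℕ.* qS a (suc n) ℕ.+ qS a n)
    ≡ val β + (k / 1)

target : (ℕ → ℕ) → ℕ → ℤ
target a n = (-1ℤ ℤ.^ (n ∸ 1)) ℤ.* (+ qS a (suc n))

module Submission where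

-- If l₁/l₂ < α < r₁/r₂ are Farey neighbours, every fraction strictly between them has
-- denominator at least l₂ + r₂.  So a β with f_β(α) ≠ 0 and max(l₂, r₂) ≤ h(β) < l₂ + r₂ is one
-- of the two endpoints, and at the endpoint with the larger denominator the neighbour of β on the
-- side of α is the other endpoint, whence f_β(α) = ± (the smaller denominator).
-- The pairs p_{n-1}/q_{n-1} and (m p_{n-1} + p_{n-2})/(m q_{n-1} + q_{n-2}), 1 ≤ m ≤ a_n, are
-- such neighbours around α, in an order given by the parity of n, and each pair arises from the
-- previous one by a mediant.  Descending along them until the sum of the two denominators
-- exceeds h(β) puts β in some E_n, and the endpoint formula gives f_β(α) = (−1)^{n−1} q_{n−1}.

open import Defs
open import Data.Bool using (Bool; true; false; not; _∧_; _∨_; if_then_else_)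
open import Data.Bool.Properties using (∨-identityʳ; ∧-zeroʳ; not-involutive)
open import Data.Empty using (⊥-elim)
open import Data.Nat as ℕ using (ℕ; zero; suc; _+_; _*_; _≤_; _<_; s≤s; z≤n; _≤?_; _<?_)
open import Data.Nat.Properties
open import Data.Nat.Divisibility using (_∣_; ∣-refl; ∣1⇒≡1; ∣m+n∣m⇒∣n; ∣m⇒∣m*n; ∣n⇒∣m*n)
open import Data.Nat.Coprimality using (Coprime)
open import Data.Nat.Tactic.RingSolver using (solve-∀)
open import Data.Integer as ℤ using (ℤ; +_; -[1+_]; -1ℤ; 1ℤ)
import Data.Integer.Properties as ℤP
open import Data.Rational as ℚ using (ℚ; mkℚ; 0ℚ; 1ℚ; ↥_; ↧ₙ_)
import Data.Rational.Properties as ℚP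
import Data.Rational.Unnormalised as ℚᵘ
import Data.Rational.Unnormalised.Properties as ℚᵘP
open import Data.Product using (Σ; _×_; _,_; proj₁; proj₂)
open import Data.Sum using (_⊎_; inj₁; inj₂)
open import Function.Bundles using (_⇔_; mk⇔)
open import Relation.Nullary using (¬_; Dec; yes; no)
open import Relation.Nullary.Decidable using (dec-true; dec-false)
open import Relation.Binary.Definitions using (tri<; tri≈; tri>)
open import Relation.Binary.PropositionalEquality

private
  frac≃mkℚᵘ : ∀ x d → ℚ.toℚᵘ (frac x (suc d)) ℚᵘ.≃ ℚᵘ.mkℚᵘ (+ x) d
  frac≃mkℚᵘ x d = ℚP.toℚᵘ-fromℚᵘ (ℚᵘ.mkℚᵘ (+ x) d)

  +*+ : ∀ m n → + m ℤ.* + n ≡ + (m * n)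
  +*+ m n = sym (ℤP.pos-* m n)

cross-<⇒frac-< : ∀ x y u v → 1 ≤ y → 1 ≤ v → x * v < u * y → frac x y ℚ.< frac u v
cross-<⇒frac-< x (suc y) u (suc v) _ _ lt = ℚP.toℚᵘ-cancel-<
  (ℚᵘP.<-respˡ-≃ (ℚᵘP.≃-sym (frac≃mkℚᵘ x y)) (ℚᵘP.<-respʳ-≃ (ℚᵘP.≃-sym (frac≃mkℚᵘ u v))
    (ℚᵘ.*<* (subst₂ ℤ._<_ (sym (+*+ x (suc v))) (sym (+*+ u (suc y))) (ℤ.+<+ lt)))))

frac-<⇒cross-< : ∀ x y u v → 1 ≤ y → 1 ≤ v → frac x y ℚ.< frac u v → x * v < u * y
frac-<⇒cross-< x (suc y) u (suc v) _ _ lt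
  with ℚᵘP.<-respˡ-≃ (frac≃mkℚᵘ x y) (ℚᵘP.<-respʳ-≃ (frac≃mkℚᵘ u v) (ℚP.toℚᵘ-mono-< lt))
... | ℚᵘ.*<* q = ℤP.drop‿+<+ (subst₂ ℤ._<_ (+*+ x (suc v)) (+*+ u (suc y)) q)

cross-≤⇒frac-≤ : ∀ x y u v → 1 ≤ y → 1 ≤ v → x * v ≤ u * y → frac x y ℚ.≤ frac u v
cross-≤⇒frac-≤ x y u v 1≤y 1≤v le = ℚP.≮⇒≥ (λ gt → <⇒≱ (frac-<⇒cross-< u v x y 1≤v 1≤y gt) le)

cross-≡⇒frac-≡ : ∀ x y u v → 1 ≤ y → 1 ≤ v → x * v ≡ u * y → frac x y ≡ frac u v
cross-≡⇒frac-≡ x (suc y) u (suc v) _ _ eq = ℚP.fromℚᵘ-cong {ℚᵘ.mkℚᵘ (+ x) y} {ℚᵘ.mkℚᵘ (+ u) v}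
  (ℚᵘ.*≡* (trans (+*+ x (suc v)) (trans (cong +_ eq) (sym (+*+ u (suc y))))))

↧ₙ-frac : ∀ x d → 1 ≤ d → Coprime x d → ↧ₙ (frac x d) ≡ d
↧ₙ-frac x (suc d) _ c = cong ↧ₙ_ (ℚP.normalize-coprime c)

numerator : QZ → ℕ
numerator δ = ℤ.∣ ↥ val δ ∣

val≡frac : (δ : QZ) → val δ ≡ frac (numerator δ) (h δ)
val≡frac δ = go (val δ) (nonneg δ)
  where
  go : (p : ℚ) → 0ℚ ℚ.≤ p → p ≡ frac ℤ.∣ ↥ p ∣ (↧ₙ p)
  go p@(mkℚ (+ _) _ _) _ = sym (ℚP.↥p/↧p≡p p)
  go (mkℚ -[1+ _ ] _ _) (ℚ.*≤* ())

fracQZ : ∀ x d → 1 ≤ d → x < d → QZ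
fracQZ x d 1≤d x<d = qz (frac x d)
  (cross-≤⇒frac-≤ 0 1 x d ≤-refl 1≤d z≤n)
  (cross-<⇒frac-< x d 1 1 1≤d ≤-refl (subst₂ _<_ (sym (*-identityʳ x)) (sym (*-identityˡ d)) x<d))

zeroQZ : QZ
zeroQZ = fracQZ 0 1 ≤-refl ≤-refl

h-pos : (β : QZ) → 1 ≤ h β
h-pos β = s≤s z≤n

nonzero⇒positive : (β : QZ) → ¬ IsZero β → 0ℚ ℚ.< val β
nonzero⇒positive β β≢0 with ℚP.<-cmp 0ℚ (val β)
... | tri< 0<β _ _ = 0<β
... | tri≈ _ 0≡β _ = ⊥-elim (β≢0 (sym 0≡β))
... | tri> _ _ β<0 = ⊥-elim (ℚP.<-irrefl refl (ℚP.≤-<-trans (nonneg β) β<0))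

1≤[1+j]/1 : ∀ j → 1ℚ ℚ.≤ (+ suc j) ℚ./ 1
1≤[1+j]/1 j = cross-≤⇒frac-≤ 1 1 (suc j) 1 ≤-refl ≤-refl (s≤s z≤n)

-[1+j]/1≤-1 : ∀ j → -[1+ j ] ℚ./ 1 ℚ.≤ ℚ.- 1ℚ
-[1+j]/1≤-1 j = ℚP.neg-antimono-≤ (1≤[1+j]/1 j)

≡-mod-1⇒≡ : (β : QZ) (k : ℤ) (B : ℚ) → 0ℚ ℚ.≤ B → B ℚ.< 1ℚ →
            B ≡ val β ℚ.+ (k ℚ./ 1) → val β ≡ B
≡-mod-1⇒≡ β (+ zero) B _ _ e = sym (trans e (ℚP.+-identityʳ (val β)))
≡-mod-1⇒≡ β (+ suc j) B _ B<1 e = ⊥-elim (ℚP.<-irrefl refl (ℚP.<-≤-trans B<1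
  (subst₂ ℚ._≤_ (ℚP.+-identityˡ 1ℚ) (sym e) (ℚP.+-mono-≤ (nonneg β) (1≤[1+j]/1 j)))))
≡-mod-1⇒≡ β -[1+ j ] B 0≤B _ e = ⊥-elim (ℚP.<-irrefl refl (ℚP.≤-<-trans 0≤B
  (subst₂ ℚ._<_ (sym e) (ℚP.+-inverseʳ 1ℚ) (ℚP.+-mono-<-≤ (lt1 β) (-[1+j]/1≤-1 j)))))

1≡-mod-1⇒IsZero : (β : QZ) (k : ℤ) → 1ℚ ≡ val β ℚ.+ (k ℚ./ 1) → IsZero β
1≡-mod-1⇒IsZero β (+ zero) e =
  ⊥-elim (ℚP.<-irrefl (sym (trans e (ℚP.+-identityʳ (val β)))) (lt1 β))
1≡-mod-1⇒IsZero β (+ suc j) e with val β ℚP.≟ 0ℚ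
... | yes β≡0 = β≡0
... | no β≢0 = ⊥-elim (ℚP.<-irrefl refl (subst₂ ℚ._<_ (ℚP.+-identityˡ 1ℚ) (sym e)
  (ℚP.+-mono-<-≤ (nonzero⇒positive β β≢0) (1≤[1+j]/1 j))))
1≡-mod-1⇒IsZero β -[1+ j ] e = ⊥-elim (ℚP.<-asym
  (subst₂ ℚ._<_ (sym e) (ℚP.+-inverseʳ 1ℚ) (ℚP.+-mono-<-≤ (lt1 β) (-[1+j]/1≤-1 j)))
  (cross-<⇒frac-< 0 1 1 1 ≤-refl ≤-refl ≤-refl))

-- l₁/l₂ and r₁/r₂ are Farey neighbours, l₁/l₂ being the left one.
Adjacent : ℕ → ℕ → ℕ → ℕ → Set
Adjacent l₁ l₂ r₁ r₂ = r₁ * l₂ ≡ l₁ * r₂ + 1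

adjacent⇒coprimeˡ : ∀ l₁ l₂ r₁ r₂ → Adjacent l₁ l₂ r₁ r₂ → Coprime l₁ l₂
adjacent⇒coprimeˡ l₁ l₂ r₁ r₂ det {d} (d∣l₁ , d∣l₂) =
  ∣1⇒≡1 (∣m+n∣m⇒∣n (subst (d ∣_) det (∣n⇒∣m*n r₁ d∣l₂)) (∣m⇒∣m*n r₂ d∣l₁))

adjacent⇒coprimeʳ : ∀ l₁ l₂ r₁ r₂ → Adjacent l₁ l₂ r₁ r₂ → Coprime r₁ r₂
adjacent⇒coprimeʳ l₁ l₂ r₁ r₂ det {d} (d∣r₁ , d∣r₂) =
  ∣1⇒≡1 (∣m+n∣m⇒∣n (subst (d ∣_) det (∣m⇒∣m*n l₂ d∣r₁)) (∣n⇒∣m*n l₁ d∣r₂))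

-- y = l₂ (r₁ y − x r₂) + r₂ (x l₂ − l₁ y), and both brackets are at least 1.
adjacent⇒between-denominator-≥ : ∀ l₁ l₂ r₁ r₂ x y → Adjacent l₁ l₂ r₁ r₂ →
                                 l₁ * y < x * l₂ → x * r₂ < r₁ * y → l₂ + r₂ ≤ y
adjacent⇒between-denominator-≥ l₁ l₂ r₁ r₂ x y det l<x x<r = +-cancelˡ-≤ (y * (l₁ * r₂)) _ _ (begin
  y * (l₁ * r₂) + (l₂ + r₂)    ≡⟨ e₁ y l₁ r₂ l₂ ⟩
  r₂ * suc (l₁ * y) + l₂       ≤⟨ +-monoˡ-≤ l₂ (*-monoʳ-≤ r₂ l<x) ⟩
  r₂ * (x * l₂) + l₂           ≡⟨ e₂ r₂ x l₂ ⟩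
  l₂ * suc (x * r₂)            ≤⟨ *-monoʳ-≤ l₂ x<r ⟩
  l₂ * (r₁ * y)                ≡⟨ e₃ l₂ r₁ y ⟩
  y * (r₁ * l₂)                ≡⟨ cong (y *_) det ⟩
  y * (l₁ * r₂ + 1)            ≡⟨ e₄ y (l₁ * r₂) ⟩
  y * (l₁ * r₂) + y            ∎)
  where
  open ≤-Reasoning
  e₁ : ∀ y l₁ r₂ l₂ → y * (l₁ * r₂) + (l₂ + r₂) ≡ r₂ * suc (l₁ * y) + l₂
  e₁ = solve-∀
  e₂ : ∀ r₂ x l₂ → r₂ * (x * l₂) + l₂ ≡ l₂ * suc (x * r₂)
  e₂ = solve-∀
  e₃ : ∀ l₂ r₁ y → l₂ * (r₁ * y) ≡ y * (r₁ * l₂)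
  e₃ = solve-∀
  e₄ : ∀ y k → y * (k + 1) ≡ y * k + y
  e₄ = solve-∀

-- b = true means x/y lies to the left of u/v.
AdjacentIf : Bool → ℕ → ℕ → ℕ → ℕ → Set
AdjacentIf true  x y u v = Adjacent x y u v
AdjacentIf false x y u v = Adjacent u v x y

adjacentIf-swap : ∀ b x y u v → AdjacentIf b x y u v → AdjacentIf (not b) u v x y
adjacentIf-swap true  _ _ _ _ adj = adj
adjacentIf-swap false _ _ _ _ adj = adj

adjacentIf-mediant : ∀ b m X₀ Y₀ X₁ Y₁ → AdjacentIf b X₀ Y₀ X₁ Y₁ →
                     AdjacentIf b (m * X₁ + X₀) (m * Y₁ + Y₀) X₁ Y₁
adjacentIf-mediant true m X₀ Y₀ X₁ Y₁ adj = begin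
  X₁ * (m * Y₁ + Y₀)              ≡⟨ e₁ m X₁ Y₁ Y₀ ⟩
  m * X₁ * Y₁ + X₁ * Y₀           ≡⟨ cong (_+_ (m * X₁ * Y₁)) adj ⟩
  m * X₁ * Y₁ + (X₀ * Y₁ + 1)     ≡⟨ e₂ m X₁ X₀ Y₁ ⟩
  (m * X₁ + X₀) * Y₁ + 1          ∎
  where
  open ≡-Reasoning
  e₁ : ∀ m X₁ Y₁ Y₀ → X₁ * (m * Y₁ + Y₀) ≡ m * X₁ * Y₁ + X₁ * Y₀
  e₁ = solve-∀
  e₂ : ∀ m X₁ X₀ Y₁ → m * X₁ * Y₁ + (X₀ * Y₁ + 1) ≡ (m * X₁ + X₀) * Y₁ + 1
  e₂ = solve-∀
adjacentIf-mediant false m X₀ Y₀ X₁ Y₁ adj = begin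
  (m * X₁ + X₀) * Y₁              ≡⟨ e₁ m X₁ X₀ Y₁ ⟩
  m * X₁ * Y₁ + X₀ * Y₁           ≡⟨ cong (_+_ (m * X₁ * Y₁)) adj ⟩
  m * X₁ * Y₁ + (X₁ * Y₀ + 1)     ≡⟨ e₂ m X₁ Y₁ Y₀ ⟩
  X₁ * (m * Y₁ + Y₀) + 1          ∎
  where
  open ≡-Reasoning
  e₁ : ∀ m X₁ X₀ Y₁ → (m * X₁ + X₀) * Y₁ ≡ m * X₁ * Y₁ + X₀ * Y₁
  e₁ = solve-∀
  e₂ : ∀ m X₁ Y₁ Y₀ → m * X₁ * Y₁ + (X₁ * Y₀ + 1) ≡ X₁ * (m * Y₁ + Y₀) + 1
  e₂ = solve-∀

private
  pencil-identity : ∀ m t X₀ Y₀ X₁ Y₁ →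
    (m * X₁ + X₀) * ((m + t) * Y₁ + Y₀) + t * (X₁ * Y₀) ≡
    ((m + t) * X₁ + X₀) * (m * Y₁ + Y₀) + t * (X₀ * Y₁)
  pencil-identity = solve-∀

  +-*-+1 : ∀ A t C → A + t * (C + 1) ≡ (A + t) + t * C
  +-*-+1 = solve-∀

pencil-≤ʳ : ∀ {m m′} X₀ Y₀ X₁ Y₁ → Adjacent X₀ Y₀ X₁ Y₁ → m ≤ m′ →
            (m * X₁ + X₀) * (m′ * Y₁ + Y₀) ≤ (m′ * X₁ + X₀) * (m * Y₁ + Y₀)
pencil-≤ʳ {m} X₀ Y₀ X₁ Y₁ adj m≤m′ with m≤n⇒∃[o]m+o≡n m≤m′
... | t , refl = ≤-trans (m≤m+n _ t) (≤-reflexive (+-cancelʳ-≡ (t * (X₀ * Y₁)) _ _ (begin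
  (m * X₁ + X₀) * ((m + t) * Y₁ + Y₀) + t + t * (X₀ * Y₁)
    ≡⟨ +-*-+1 _ t (X₀ * Y₁) ⟨
  (m * X₁ + X₀) * ((m + t) * Y₁ + Y₀) + t * (X₀ * Y₁ + 1)
    ≡⟨ cong (λ z → (m * X₁ + X₀) * ((m + t) * Y₁ + Y₀) + t * z) adj ⟨
  (m * X₁ + X₀) * ((m + t) * Y₁ + Y₀) + t * (X₁ * Y₀)
    ≡⟨ pencil-identity m t X₀ Y₀ X₁ Y₁ ⟩
  ((m + t) * X₁ + X₀) * (m * Y₁ + Y₀) + t * (X₀ * Y₁) ∎)))
  where open ≡-Reasoning

pencil-≤ˡ : ∀ {m m′} X₀ Y₀ X₁ Y₁ → Adjacent X₁ Y₁ X₀ Y₀ → m ≤ m′ →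
            (m′ * X₁ + X₀) * (m * Y₁ + Y₀) ≤ (m * X₁ + X₀) * (m′ * Y₁ + Y₀)
pencil-≤ˡ {m} X₀ Y₀ X₁ Y₁ adj m≤m′ with m≤n⇒∃[o]m+o≡n m≤m′
... | t , refl = ≤-trans (m≤m+n _ t) (≤-reflexive (+-cancelʳ-≡ (t * (X₁ * Y₀)) _ _ (begin
  ((m + t) * X₁ + X₀) * (m * Y₁ + Y₀) + t + t * (X₁ * Y₀)
    ≡⟨ +-*-+1 _ t (X₁ * Y₀) ⟨
  ((m + t) * X₁ + X₀) * (m * Y₁ + Y₀) + t * (X₁ * Y₀ + 1)
    ≡⟨ cong (λ z → ((m + t) * X₁ + X₀) * (m * Y₁ + Y₀) + t * z) adj ⟨
  ((m + t) * X₁ + X₀) * (m * Y₁ + Y₀) + t * (X₀ * Y₁)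
    ≡⟨ pencil-identity m t X₀ Y₀ X₁ Y₁ ⟨
  (m * X₁ + X₀) * ((m + t) * Y₁ + Y₀) + t * (X₁ * Y₀) ∎)))
  where open ≡-Reasoning

frac<1⇒< : ∀ x d → 1 ≤ d → frac x d ℚ.< 1ℚ → x < d
frac<1⇒< x d 1≤d lt =
  subst₂ _<_ (*-identityʳ x) (*-identityˡ d) (frac-<⇒cross-< x d 1 1 1≤d ≤-refl lt)

prev<β : ∀ β β′ → ¬ IsZero β → IsPrev β β′ → val β′ ℚ.< val β
prev<β β β′ β≢0 (_ , β′≢β , free) with ℚP.<-cmp (val β′) (val β)
... | tri< β′<β _ _ = β′<β
... | tri≈ _ β′≡β _ = ⊥-elim (β′≢β β′≡β)
... | tri> _ _ β<β′ = ⊥-elim (free zeroQZ (h-pos β) (inj₂ (β<β′ , inj₂ (nonzero⇒positive β β≢0))))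

β<next⊎next≡0 : ∀ β β″ → ¬ IsZero β → IsNext β β″ → val β ℚ.< val β″ ⊎ IsZero β″
β<next⊎next≡0 β β″ β≢0 (_ , β″≢β , free) with ℚP.<-cmp (val β) (val β″)
... | tri< β<β″ _ _ = inj₁ β<β″
... | tri≈ _ β≡β″ _ = ⊥-elim (β″≢β (sym β≡β″))
... | tri> _ _ β″<β with val β″ ℚP.≟ 0ℚ
...   | yes β″≡0 = inj₂ β″≡0
...   | no β″≢0 = ⊥-elim (free zeroQZ (h-pos β) (inj₂ (β″<β , inj₂ (nonzero⇒positive β″ β″≢0))))

true≢false : true ≢ false
true≢false ()

∧-not≡true : ∀ b c → b ∧ not c ≡ true → b ≡ true × c ≡ false
∧-not≡true true false _ = refl , refl
∧-not≡true true true ()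
∧-not≡true false _ ()

module _ (α : Irr01) where

  below-≤-true : ∀ {r s} → r ℚ.≤ s → below α s ≡ true → below α r ≡ true
  below-≤-true {r} {s} = mono α r s

  below-≤-false : ∀ {r s} → r ℚ.≤ s → below α r ≡ false → below α s ≡ false
  below-≤-false {r} {s} r≤s br with below α s in bs
  ... | false = refl
  ... | true = trans (sym (mono α r s r≤s bs)) br

  below-true-false⇒< : ∀ {r s} → below α r ≡ true → below α s ≡ false → r ℚ.< s
  below-true-false⇒< {r} {s} br bs with r ℚP.<? s
  ... | yes r<s = r<s
  ... | no r≮s = ⊥-elim (true≢false (trans (sym (below-≤-true (ℚP.≮⇒≥ r≮s) br)) bs))

  private
    αInArc-by : ℚ → ℚ → Bool → Bool
    αInArc-by x y b = if b then below α x ∧ not (below α y) else below α x ∨ not (below α y)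

  αInArc-increasing : ∀ {x y} → x ℚ.< y → αInArc α x y ≡ (below α x ∧ not (below α y))
  αInArc-increasing {x} {y} x<y = cong (αInArc-by x y) (dec-true (x ℚP.<? y) x<y)

  αInArc-to-0 : ∀ {x y} → 0ℚ ℚ.< x → y ≡ 0ℚ → αInArc α x y ≡ below α x
  αInArc-to-0 {x} 0<x refl = begin
    αInArc α x 0ℚ                 ≡⟨ cong (αInArc-by x 0ℚ) (dec-false (x ℚP.<? 0ℚ) (ℚP.<-asym 0<x)) ⟩
    below α x ∨ not (below α 0ℚ)  ≡⟨ cong (λ b → below α x ∨ not b) (pos α) ⟩
    below α x ∨ false             ≡⟨ ∨-identityʳ (below α x) ⟩
    below α x                     ∎
    where open ≡-Reasoning

  αInArc⇒below : ∀ {x y} → x ℚ.< y → αInArc α x y ≡ true → below α x ≡ true × below α y ≡ false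
  αInArc⇒below {x} {y} x<y e = ∧-not≡true (below α x) (below α y) (trans (sym (αInArc-increasing x<y)) e)

  below⇒αInArc : ∀ {x y} → x ℚ.< y → below α x ≡ true → below α y ≡ false → αInArc α x y ≡ true
  below⇒αInArc {x} {y} x<y bx by = trans (αInArc-increasing x<y) (cong₂ (λ b c → b ∧ not c) bx by)

  below⇒¬αInArc : ∀ {x y} → x ℚ.< y → below α y ≡ true → αInArc α x y ≡ false
  below⇒¬αInArc {x} {y} x<y by =
    trans (αInArc-increasing x<y) (trans (cong (λ c → below α x ∧ not c) by) (∧-zeroʳ (below α x)))

  fAt-zero : ∀ β β′ β″ → IsZero β → fAt α β β′ β″ ≡ + 1
  fAt-zero β β′ β″ β≡0 with val β ℚP.≟ 0ℚ
  ... | yes _ = refl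
  ... | no β≢0 = ⊥-elim (β≢0 β≡0)

  fAt-left : ∀ β β′ β″ → ¬ IsZero β → αInArc α (val β′) (val β) ≡ true → fAt α β β′ β″ ≡ + h β′
  fAt-left β β′ β″ β≢0 e with val β ℚP.≟ 0ℚ
  ... | yes β≡0 = ⊥-elim (β≢0 β≡0)
  ... | no _ rewrite e = refl

  fAt-right : ∀ β β′ β″ → ¬ IsZero β → αInArc α (val β′) (val β) ≡ false →
              αInArc α (val β) (val β″) ≡ true → fAt α β β′ β″ ≡ ℤ.- (+ h β″)
  fAt-right β β′ β″ β≢0 e e′ with val β ℚP.≟ 0ℚ
  ... | yes β≡0 = ⊥-elim (β≢0 β≡0)
  ... | no _ rewrite e | e′ = refl

  fAt≢0⇒αInArc : ∀ β β′ β″ → ¬ IsZero β → fAt α β β′ β″ ≢ + 0 →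
                 αInArc α (val β′) (val β) ≡ true ⊎ αInArc α (val β) (val β″) ≡ true
  fAt≢0⇒αInArc β β′ β″ β≢0 f≢0 with val β ℚP.≟ 0ℚ
  ... | yes β≡0 = ⊥-elim (β≢0 β≡0)
  ... | no _ with αInArc α (val β′) (val β) | αInArc α (val β) (val β″)
  ...   | true  | _     = inj₁ refl
  ...   | false | true  = inj₂ refl
  ...   | false | false = ⊥-elim (f≢0 refl)

  record Straddle (l₁ l₂ r₁ r₂ : ℕ) : Set where
    field
      l₂-pos      : 1 ≤ l₂
      r₂-pos      : 1 ≤ r₂
      adjacent    : Adjacent l₁ l₂ r₁ r₂
      left-below  : below α (frac l₁ l₂) ≡ true
      right-above : below α (frac r₁ r₂) ≡ false

  module Straddling {l₁ l₂ r₁ r₂ : ℕ} (s : Straddle l₁ l₂ r₁ r₂) where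
    open Straddle s

    L R : ℚ
    L = frac l₁ l₂
    R = frac r₁ r₂

    L<R : L ℚ.< R
    L<R = below-true-false⇒< left-below right-above

    l₁<l₂ : l₁ < l₂
    l₁<l₂ = frac<1⇒< l₁ l₂ l₂-pos (below-true-false⇒< left-below (less1 α))

    r₁≤r₂ : r₁ ≤ r₂
    r₁≤r₂ = ≮⇒≥ λ r₂<r₁ → <⇒≱ (+-mono-≤ l₂-pos r₂-pos)
      (adjacent⇒between-denominator-≥ l₁ l₂ r₁ r₂ 1 1 adjacent
        (subst₂ _<_ (sym (*-identityʳ l₁)) (sym (*-identityˡ l₂)) l₁<l₂)
        (subst₂ _<_ (sym (*-identityˡ r₂)) (sym (*-identityʳ r₁)) r₂<r₁))

    αInArc-L-R : ∀ {x y} → x ≡ L → y ≡ R → αInArc α x y ≡ true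
    αInArc-L-R refl refl = below⇒αInArc L<R left-below right-above

    r₁≡r₂⇒r₂≡1 : r₁ ≡ r₂ → r₂ ≡ 1
    r₁≡r₂⇒r₂≡1 r₁≡r₂ = adjacent⇒coprimeʳ l₁ l₂ r₁ r₂ adjacent (subst (_∣ r₁) r₁≡r₂ ∣-refl , ∣-refl)

    QL : QZ
    QL = fracQZ l₁ l₂ l₂-pos l₁<l₂

    QR : r₁ < r₂ → QZ
    QR r₁<r₂ = fracQZ r₁ r₂ r₂-pos r₁<r₂

    h≡l₂ : (δ : QZ) → val δ ≡ L → h δ ≡ l₂
    h≡l₂ δ δ≡L = trans (cong ↧ₙ_ δ≡L) (↧ₙ-frac l₁ l₂ l₂-pos (adjacent⇒coprimeˡ l₁ l₂ r₁ r₂ adjacent))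

    h≡r₂ : (δ : QZ) → val δ ≡ R → h δ ≡ r₂
    h≡r₂ δ δ≡R = trans (cong ↧ₙ_ δ≡R) (↧ₙ-frac r₁ r₂ r₂-pos (adjacent⇒coprimeʳ l₁ l₂ r₁ r₂ adjacent))

    between⇒≥ : (δ : QZ) → L ℚ.< val δ → val δ ℚ.< R → l₂ + r₂ ≤ h δ
    between⇒≥ δ L<δ δ<R = adjacent⇒between-denominator-≥ l₁ l₂ r₁ r₂ (numerator δ) (h δ) adjacent
      (frac-<⇒cross-< l₁ l₂ (numerator δ) (h δ) l₂-pos (h-pos δ) (subst (L ℚ.<_) (val≡frac δ) L<δ))
      (frac-<⇒cross-< (numerator δ) (h δ) r₁ r₂ (h-pos δ) r₂-pos (subst (ℚ._< R) (val≡frac δ) δ<R))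

    module _ (β β′ β″ : QZ) (β≢0 : ¬ IsZero β) (prev : IsPrev β β′) (next : IsNext β β″) where

      private
        β′<β : val β′ ℚ.< val β
        β′<β = prev<β β β′ β≢0 prev

        0<β : 0ℚ ℚ.< val β
        0<β = nonzero⇒positive β β≢0

        nothing-before : ∀ δ → h δ ≤ h β → ¬ InArc (val β′) (val β) (val δ)
        nothing-before = proj₂ (proj₂ prev)

        nothing-after : ∀ δ → h δ ≤ h β → ¬ InArc (val β) (val β″) (val δ)
        nothing-after = proj₂ (proj₂ next)

      αInArc-next⇒below : αInArc α (val β) (val β″) ≡ true → below α (val β) ≡ true
      αInArc-next⇒below e with β<next⊎next≡0 β β″ β≢0 next
      ... | inj₁ β<β″ = proj₁ (αInArc⇒below β<β″ e)
      ... | inj₂ β″≡0 = trans (sym (αInArc-to-0 0<β β″≡0)) e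

      ¬β<L : fAt α β β′ β″ ≢ + 0 → l₂ ≤ h β → ¬ val β ℚ.< L
      ¬β<L f≢0 l₂≤h β<L with fAt≢0⇒αInArc β β′ β″ β≢0 f≢0
      ... | inj₁ e = true≢false (trans (sym (below-≤-true (ℚP.<⇒≤ β<L) left-below))
                                       (proj₂ (αInArc⇒below β′<β e)))
      ... | inj₂ e = nothing-after QL (subst (_≤ h β) (sym (h≡l₂ QL refl)) l₂≤h) L-after-β
        where
        L-after-β : InArc (val β) (val β″) L
        L-after-β with β<next⊎next≡0 β β″ β≢0 next
        ... | inj₁ β<β″ = inj₁ (β<β″ , β<L , below-true-false⇒< left-below (proj₂ (αInArc⇒below β<β″ e)))
        ... | inj₂ β″≡0 = inj₂ (subst (ℚ._< val β) (sym β″≡0) 0<β , inj₁ β<L)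

      ¬R<β : fAt α β β′ β″ ≢ + 0 → r₂ ≤ h β → ¬ R ℚ.< val β
      ¬R<β f≢0 r₂≤h R<β with fAt≢0⇒αInArc β β′ β″ β≢0 f≢0
      ... | inj₂ e = true≢false (trans (sym (αInArc-next⇒below e))
                                       (below-≤-false (ℚP.<⇒≤ R<β) right-above))
      ... | inj₁ e = nothing-before (QR r₁<r₂) (subst (_≤ h β) (sym (h≡r₂ (QR r₁<r₂) refl)) r₂≤h)
                       (inj₁ (β′<β , below-true-false⇒< (proj₁ (αInArc⇒below β′<β e)) right-above , R<β))
        where
        r₁<r₂ : r₁ < r₂
        r₁<r₂ = frac<1⇒< r₁ r₂ r₂-pos (ℚP.<-trans R<β (lt1 β))

      nonvanishing⇒endpoint : fAt α β β′ β″ ≢ + 0 → l₂ ≤ h β → r₂ ≤ h β → h β < l₂ + r₂ →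
                              val β ≡ L ⊎ val β ≡ R
      nonvanishing⇒endpoint f≢0 l₂≤h r₂≤h h<l₂+r₂ with ℚP.<-cmp (val β) L | ℚP.<-cmp (val β) R
      ... | tri≈ _ β≡L _ | _              = inj₁ β≡L
      ... | _            | tri≈ _ β≡R _   = inj₂ β≡R
      ... | tri< β<L _ _ | _              = ⊥-elim (¬β<L f≢0 l₂≤h β<L)
      ... | _            | tri> _ _ R<β   = ⊥-elim (¬R<β f≢0 r₂≤h R<β)
      ... | tri> _ _ L<β | tri< β<R _ _   = ⊥-elim (<⇒≱ h<l₂+r₂ (between⇒≥ β L<β β<R))

      prev-of-right : val β ≡ R → l₂ ≤ r₂ → val β′ ≡ L
      prev-of-right β≡R l₂≤r₂ with ℚP.<-cmp (val β′) L
      ... | tri≈ _ β′≡L _ = β′≡L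
      ... | tri< β′<L _ _ = ⊥-elim (nothing-before QL
                                  (subst₂ _≤_ (sym (h≡l₂ QL refl)) (sym (h≡r₂ β β≡R)) l₂≤r₂)
                                  (inj₁ (β′<β , β′<L , subst (L ℚ.<_) (sym β≡R) L<R)))
      ... | tri> _ _ L<β′ = ⊥-elim (<⇒≱ (m<n+m r₂ l₂-pos)
                                  (≤-trans (between⇒≥ β′ L<β′ (subst (val β′ ℚ.<_) β≡R β′<β))
                                           (subst (h β′ ≤_) (h≡r₂ β β≡R) (proj₁ prev))))

      fAt-right-endpoint : val β ≡ R → l₂ ≤ r₂ → fAt α β β′ β″ ≡ + l₂
      fAt-right-endpoint β≡R l₂≤r₂ = trans (fAt-left β β′ β″ β≢0 α∈I) (cong +_ (h≡l₂ β′ β′≡L))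
        where
        β′≡L : val β′ ≡ L
        β′≡L = prev-of-right β≡R l₂≤r₂
        α∈I : αInArc α (val β′) (val β) ≡ true
        α∈I = αInArc-L-R β′≡L β≡R

      private
        ¬between-next : val β ≡ L → val β ℚ.< val β″ → ¬ val β″ ℚ.< R
        ¬between-next β≡L β<β″ β″<R = <⇒≱ (m<m+n l₂ r₂-pos)
          (≤-trans (between⇒≥ β″ (subst (ℚ._< val β″) β≡L β<β″) β″<R)
                   (subst (h β″ ≤_) (h≡l₂ β β≡L) (proj₁ next)))

      next-of-left-< : val β ≡ L → r₂ ≤ l₂ → r₁ < r₂ → val β″ ≡ R
      next-of-left-< β≡L r₂≤l₂ r₁<r₂ = by-cases (β<next⊎next≡0 β β″ β≢0 next)
        where
        hR≤hβ : h (QR r₁<r₂) ≤ h β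
        hR≤hβ = subst₂ _≤_ (sym (h≡r₂ (QR r₁<r₂) refl)) (sym (h≡l₂ β β≡L)) r₂≤l₂
        β<R : val β ℚ.< R
        β<R = subst (ℚ._< R) (sym β≡L) L<R
        by-cases : val β ℚ.< val β″ ⊎ IsZero β″ → val β″ ≡ R
        by-cases (inj₂ β″≡0) =
          ⊥-elim (nothing-after (QR r₁<r₂) hR≤hβ (inj₂ (subst (ℚ._< val β) (sym β″≡0) 0<β , inj₁ β<R)))
        by-cases (inj₁ β<β″) with ℚP.<-cmp (val β″) R
        ... | tri≈ _ β″≡R _ = β″≡R
        ... | tri< β″<R _ _ = ⊥-elim (¬between-next β≡L β<β″ β″<R)
        ... | tri> _ _ R<β″ = ⊥-elim (nothing-after (QR r₁<r₂) hR≤hβ (inj₁ (β<β″ , β<R , R<β″)))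

      next-of-left-≡ : val β ≡ L → r₁ ≡ r₂ → IsZero β″
      next-of-left-≡ β≡L r₁≡r₂ with β<next⊎next≡0 β β″ β≢0 next
      ... | inj₂ β″≡0 = β″≡0
      ... | inj₁ β<β″ = ⊥-elim (¬between-next β≡L β<β″ (subst (val β″ ℚ.<_) 1≡R (lt1 β″)))
        where
        1≡R : 1ℚ ≡ R
        1≡R = cross-≡⇒frac-≡ 1 1 r₁ r₂ ≤-refl r₂-pos
                (trans (*-identityˡ r₂) (trans (sym r₁≡r₂) (sym (*-identityʳ r₁))))

      -- When R = 1 the successor of L is the point 0 of Q/Z, whose height is r₂ = 1 as well.
      next-of-left : val β ≡ L → r₂ ≤ l₂ → h β″ ≡ r₂ × αInArc α (val β) (val β″) ≡ true
      next-of-left β≡L r₂≤l₂ with m≤n⇒m<n∨m≡n r₁≤r₂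
      ... | inj₁ r₁<r₂ = h≡r₂ β″ β″≡R ,
          αInArc-L-R β≡L β″≡R
        where
        β″≡R = next-of-left-< β≡L r₂≤l₂ r₁<r₂
      ... | inj₂ r₁≡r₂ = trans (cong ↧ₙ_ β″≡0) (sym (r₁≡r₂⇒r₂≡1 r₁≡r₂)) ,
          trans (αInArc-to-0 0<β β″≡0) (trans (cong (below α) β≡L) left-below)
        where
        β″≡0 = next-of-left-≡ β≡L r₁≡r₂

      fAt-left-endpoint : val β ≡ L → r₂ ≤ l₂ → fAt α β β′ β″ ≡ ℤ.- (+ r₂)
      fAt-left-endpoint β≡L r₂≤l₂ =
        trans (fAt-right β β′ β″ β≢0 α∉I (proj₂ successor)) (cong (λ n → ℤ.- (+ n)) (proj₁ successor))
        where
        successor = next-of-left β≡L r₂≤l₂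
        α∉I = below⇒¬αInArc β′<β (trans (cong (below α) β≡L) left-below)

m≤n*m+o : ∀ m n o → 1 ≤ n → m ≤ n * m + o
m≤n*m+o m n o 1≤n = ≤-trans (m≤n*m m n {{ℕ.>-nonZero 1≤n}}) (m≤m+n (n * m) o)

-1^≡ : ∀ j → -1ℤ ℤ.^ j ≡ (if evenB j then 1ℤ else -1ℤ)
-1^≡ zero = refl
-1^≡ (suc j) with evenB j | -1^≡ j
... | true  | e = cong (-1ℤ ℤ.*_) e
... | false | e = cong (-1ℤ ℤ.*_) e

signed : Bool → ℕ → ℤ
signed true  q = ℤ.- (+ q)
signed false q = + q

signed≢0 : ∀ b q → 1 ≤ q → signed b q ≢ + 0
signed≢0 true  (suc q) _ ()
signed≢0 false (suc q) _ ()

<-+suc⇒< : ∀ {h d e} f → 1 ≤ d → h < e + suc f → h < d + e + f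
<-+suc⇒< {h} {d} {e} f 1≤d h< = <-≤-trans h< (begin
  e + suc f    ≡⟨ +-suc e f ⟩
  suc e + f    ≤⟨ +-monoˡ-≤ f (+-monoˡ-≤ e 1≤d) ⟩
  d + e + f    ∎)
  where open ≤-Reasoning

even⇒2≤ : ∀ {n} → 1 ≤ n → evenB n ≡ true → 2 ≤ n
even⇒2≤ {suc zero} _ ()
even⇒2≤ {suc (suc _)} _ _ = s≤s (s≤s z≤n)

-- P (k + 2) = p_k and Q (k + 2) = q_k; intP n m / intQ n m is the m-th element of E_n.
module Convergents (a : ℕ → ℕ) where

  P Q : ℕ → ℕ
  P = pS a
  Q = qS a

  intP intQ : ℕ → ℕ → ℕ
  intP n m = m * P (suc n) + P n
  intQ n m = m * Q (suc n) + Q n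

  convergents-adjacent : ∀ k → AdjacentIf (evenB k) (P k) (Q k) (P (suc k)) (Q (suc k))
  convergents-adjacent zero    = refl
  convergents-adjacent (suc k) = adjacentIf-swap (evenB k) _ _ _ _
    (adjacentIf-mediant (evenB k) (a k) (P k) (Q k) (P (suc k)) (Q (suc k)) (convergents-adjacent k))

  intermediate-adjacent : ∀ {b} n m → evenB n ≡ b → AdjacentIf b (intP n m) (intQ n m) (P (suc n)) (Q (suc n))
  intermediate-adjacent n m refl = adjacentIf-mediant (evenB n) m _ _ _ _ (convergents-adjacent n)

  Q≤intQ : ∀ n m → 1 ≤ m → Q (suc n) ≤ intQ n m
  Q≤intQ n m 1≤m = m≤n*m+o (Q (suc n)) m (Q n) 1≤m

  intQ-suc : ∀ n m → intQ n (suc m) ≡ Q (suc n) + intQ n m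
  intQ-suc n m = +-assoc (Q (suc n)) (m * Q (suc n)) (Q n)

  intQ-next : ∀ n → intQ (suc n) 1 ≡ Q (suc n) + intQ n (a n)
  intQ-next n = trans (cong (_+ Q (suc n)) (*-identityˡ (intQ n (a n)))) (+-comm (intQ n (a n)) (Q (suc n)))

  Q₂≡1 : Q 2 ≡ 1
  Q₂≡1 = cong (_+ 1) (*-zeroʳ (a 0))

  P₂≡0 : a 0 ≡ 0 → P 2 ≡ 0
  P₂≡0 a₀≡0 = cong (λ x → x * 1 + 0) a₀≡0

  target≡signed : ∀ {n} → 1 ≤ n → target a n ≡ signed (evenB n) (Q (suc n))
  target≡signed {suc j} _ with evenB j | -1^≡ j
  ... | true  | e = trans (cong (ℤ._* + Q (suc (suc j))) e) (ℤP.*-identityˡ _)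
  ... | false | e = trans (cong (ℤ._* + Q (suc (suc j))) e) (ℤP.-1*i≡-i _)

  module _ (a-pos : ∀ n → 1 ≤ a (suc n)) where

    Q-pos : ∀ {n} → 1 ≤ n → 1 ≤ Q (suc n)
    Q-pos {suc zero}    _ = m≤n+m 1 (a 0 * 0)
    Q-pos {suc (suc k)} _ = ≤-trans (Q-pos {suc k} (s≤s z≤n)) (m≤n*m+o _ (a (suc k)) _ (a-pos k))

    P-pos : ∀ {n} → 2 ≤ n → 1 ≤ P (suc n)
    P-pos {suc zero} (s≤s ())
    P-pos {suc (suc zero)}    _ = m≤n+m 1 (a 1 * P 2)
    P-pos {suc (suc (suc k))} _ =
      ≤-trans (P-pos {suc (suc k)} (s≤s (s≤s z≤n))) (m≤n*m+o _ (a (suc (suc k))) _ (a-pos (suc k)))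

    intQ-pos : ∀ {n m} → 1 ≤ n → 1 ≤ m → 1 ≤ intQ n m
    intQ-pos {n} {m} 1≤n 1≤m = ≤-trans (Q-pos 1≤n) (Q≤intQ n m 1≤m)

module ContinuedFraction (α : Irr01) (a : ℕ → ℕ) (cf : IsCF α a) where
  open Convergents a

  private
    a-pos : ∀ n → 1 ≤ a (suc n)
    a-pos = proj₁ (proj₂ cf)

    convergent-side : ∀ n → below α (conv a n) ≡ evenB n
    convergent-side = proj₂ (proj₂ cf)

  previous-convergent-side : ∀ {n} → 1 ≤ n → below α (frac (P (suc n)) (Q (suc n))) ≡ not (evenB n)
  previous-convergent-side {suc j} _ = trans (convergent-side j) (sym (not-involutive (evenB j)))

  intermediate-side : ∀ {n m} → 1 ≤ n → 1 ≤ m → m ≤ a n →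
                      below α (frac (intP n m) (intQ n m)) ≡ evenB n
  intermediate-side {n} {m} 1≤n 1≤m m≤a
    with evenB n | convergents-adjacent n | convergent-side n
  ... | true  | adj | side = below-≤-true α (cross-≤⇒frac-≤ _ _ _ _ (intQ-pos a-pos 1≤n 1≤m)
                               (intQ-pos a-pos 1≤n (≤-trans 1≤m m≤a)) (pencil-≤ʳ _ _ _ _ adj m≤a)) side
  ... | false | adj | side = below-≤-false α (cross-≤⇒frac-≤ _ _ _ _ (intQ-pos a-pos 1≤n (≤-trans 1≤m m≤a))
                               (intQ-pos a-pos 1≤n 1≤m) (pencil-≤ˡ _ _ _ _ adj m≤a)) side

  straddle-odd : ∀ {n m} → 1 ≤ n → 1 ≤ m → m ≤ a n → evenB n ≡ false →
                 Straddle α (P (suc n)) (Q (suc n)) (intP n m) (intQ n m)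
  straddle-odd {n} {m} 1≤n 1≤m m≤a odd = record
    { l₂-pos      = Q-pos a-pos 1≤n
    ; r₂-pos      = intQ-pos a-pos 1≤n 1≤m
    ; adjacent    = intermediate-adjacent n m odd
    ; left-below  = trans (previous-convergent-side 1≤n) (cong not odd)
    ; right-above = trans (intermediate-side 1≤n 1≤m m≤a) odd
    }

  straddle-even : ∀ {n m} → 1 ≤ n → 1 ≤ m → m ≤ a n → evenB n ≡ true →
                  Straddle α (intP n m) (intQ n m) (P (suc n)) (Q (suc n))
  straddle-even {n} {m} 1≤n 1≤m m≤a even = record
    { l₂-pos      = intQ-pos a-pos 1≤n 1≤m
    ; r₂-pos      = Q-pos a-pos 1≤n
    ; adjacent    = intermediate-adjacent n m even
    ; left-below  = trans (intermediate-side 1≤n 1≤m m≤a) even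
    ; right-above = trans (previous-convergent-side 1≤n) (cong not even)
    }

  InSomeE : QZ → Set
  InSomeE β = Σ ℕ λ n → 1 ≤ n × InE a n β

  intermediate∈E : ∀ {n m} (β : QZ) → 1 ≤ m → m ≤ a n → val β ≡ frac (intP n m) (intQ n m) → InE a n β
  intermediate∈E β 1≤m m≤a B≡β+k = _ , 1≤m , m≤a , + 0 , trans (sym B≡β+k) (sym (ℚP.+-identityʳ (val β)))

  zero∈E₁ : (β : QZ) → IsZero β → InE a 1 β
  zero∈E₁ β β≡0 = 1 , ≤-refl , a-pos 0 , + 1 , (begin
    frac (1 * P 2 + P 1) (1 * Q 2 + Q 1)
      ≡⟨ cong₂ (λ p q → frac (1 * p + 1) (1 * q + 0)) (P₂≡0 (proj₁ cf)) Q₂≡1 ⟩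
    1ℚ                                    ≡⟨ ℚP.+-identityˡ 1ℚ ⟨
    0ℚ ℚ.+ 1ℚ                             ≡⟨ cong (ℚ._+ 1ℚ) β≡0 ⟨
    val β ℚ.+ 1ℚ                          ∎)
    where open ≡-Reasoning

  convergent∈E : ∀ {n} (β : QZ) → 1 ≤ n → val β ≡ frac (P (suc n)) (Q (suc n)) → InSomeE β
  convergent∈E {suc zero} β _ β≡A =
    1 , ≤-refl , zero∈E₁ β (trans β≡A (cong₂ frac (P₂≡0 (proj₁ cf)) Q₂≡1))
  convergent∈E {suc (suc k)} β _ β≡A = suc k , s≤s z≤n , intermediate∈E β (a-pos k) ≤-refl β≡A

  module _ (β β′ β″ : QZ) (β≢0 : ¬ IsZero β) (prev : IsPrev β β′) (next : IsNext β β″)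
           (f≢0 : fAt α β β′ β″ ≢ + 0) where

    endpoint∈E : ∀ {n m} → 1 ≤ n → 1 ≤ m → m ≤ a n → intQ n m ≤ h β →
                 h β < Q (suc n) + intQ n m → InSomeE β
    endpoint∈E {n} {m} 1≤n 1≤m m≤a intQ≤h h< with evenB n in parity
    ... | false with Straddling.nonvanishing⇒endpoint α (straddle-odd 1≤n 1≤m m≤a parity)
                      β β′ β″ β≢0 prev next f≢0 (≤-trans (Q≤intQ n m 1≤m) intQ≤h) intQ≤h h<
    ...   | inj₁ β≡A = convergent∈E β 1≤n β≡A
    ...   | inj₂ B≡β+k = n , 1≤n , intermediate∈E β 1≤m m≤a B≡β+k
    endpoint∈E {n} {m} 1≤n 1≤m m≤a intQ≤h h< | true
                with Straddling.nonvanishing⇒endpoint α (straddle-even 1≤n 1≤m m≤a parity)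
                      β β′ β″ β≢0 prev next f≢0 intQ≤h (≤-trans (Q≤intQ n m 1≤m) intQ≤h)
                      (subst (h β <_) (+-comm (Q (suc n)) (intQ n m)) h<)
    ...   | inj₁ B≡β+k = n , 1≤n , intermediate∈E β 1≤m m≤a B≡β+k
    ...   | inj₂ β≡A = convergent∈E β 1≤n β≡A

    -- Walk along the intermediate convergents towards α; each step adds q_{n-1} ≥ 1 to the
    -- denominator intQ n m, so h β serves as fuel.
    descend : ∀ fuel {n m} → 1 ≤ n → 1 ≤ m → m ≤ a n → intQ n m ≤ h β →
              h β < intQ n m + fuel → InSomeE β
    descend zero {n} {m} _ _ _ intQ≤h h< =
      ⊥-elim (<⇒≱ (subst (h β <_) (+-identityʳ (intQ n m)) h<) intQ≤h)
    descend (suc fuel) {n} {m} 1≤n 1≤m m≤a intQ≤h h< with Q (suc n) + intQ n m ≤? h β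
    ... | no sum≰h = endpoint∈E 1≤n 1≤m m≤a intQ≤h (≰⇒> sum≰h)
    ... | yes sum≤h with m <? a n
    ...   | yes m<a = descend fuel 1≤n (s≤s z≤n) m<a
                        (subst (_≤ h β) (sym (intQ-suc n m)) sum≤h)
                        (subst (λ d → h β < d + fuel) (sym (intQ-suc n m))
                          (<-+suc⇒< fuel (Q-pos a-pos 1≤n) h<))
    ...   | no m≮a with ≤-antisym m≤a (≮⇒≥ m≮a)
    ...     | refl = descend fuel (s≤s z≤n) ≤-refl (a-pos n)
                        (subst (_≤ h β) (sym (intQ-next n)) sum≤h)
                        (subst (λ d → h β < d + fuel) (sym (intQ-next n))
                          (<-+suc⇒< fuel (Q-pos a-pos 1≤n) h<))

    nonvanishing⇒InSomeE : InSomeE β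
    nonvanishing⇒InSomeE = descend (h β) {1} {1} ≤-refl ≤-refl (a-pos 0)
      (subst (_≤ h β) (sym intQ₁₁≡1) (h-pos β)) (subst (λ d → h β < d + h β) (sym intQ₁₁≡1) ≤-refl)
      where
      intQ₁₁≡1 : intQ 1 1 ≡ 1
      intQ₁₁≡1 = cong (λ q → 1 * q + 0) Q₂≡1

  module _ (β β′ β″ : QZ) (neighbours : ¬ IsZero β → IsPrev β β′ × IsNext β β″)
           {n m : ℕ} (k : ℤ) (1≤n : 1 ≤ n) (1≤m : 1 ≤ m) (m≤a : m ≤ a n)
           (B≡β+k : frac (intP n m) (intQ n m) ≡ val β ℚ.+ (k ℚ./ 1)) where

    private
      B = frac (intP n m) (intQ n m)

      val≡B : intP n m < intQ n m → val β ≡ B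
      val≡B intP<intQ = ≡-mod-1⇒≡ β k B
        (cross-≤⇒frac-≤ 0 1 (intP n m) (intQ n m) ≤-refl (intQ-pos a-pos 1≤n 1≤m) z≤n)
        (cross-<⇒frac-< (intP n m) (intQ n m) 1 1 (intQ-pos a-pos 1≤n 1≤m) ≤-refl
          (subst₂ _<_ (sym (*-identityʳ _)) (sym (*-identityˡ _)) intP<intQ))
        B≡β+k

      B≢0 : 0ℚ ℚ.< B → intP n m < intQ n m → ¬ IsZero β
      B≢0 0<B intP<intQ β≡0 = ℚP.<-irrefl (trans (sym β≡0) (val≡B intP<intQ)) 0<B

    fAt-odd : evenB n ≡ false → fAt α β β′ β″ ≡ + Q (suc n)
    fAt-odd odd = by-cases (m≤n⇒m<n∨m≡n r₁≤r₂)
      where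
      straddle = straddle-odd 1≤n 1≤m m≤a odd
      open Straddle straddle
      open Straddling α straddle
      by-cases : intP n m < intQ n m ⊎ intP n m ≡ intQ n m → fAt α β β′ β″ ≡ + Q (suc n)
      by-cases (inj₁ intP<intQ) = fAt-right-endpoint β β′ β″ β≢0 (proj₁ (neighbours β≢0))
                                    (proj₂ (neighbours β≢0)) (val≡B intP<intQ) (Q≤intQ n m 1≤m)
        where
        β≢0 = B≢0 (below-true-false⇒< α (pos α) right-above) intP<intQ
      -- Here B = 1 ≡ 0 mod 1, so β = 0 and f_β(α) = 1, while 1 ≤ q_{n-1} ≤ intQ n m = 1.
      by-cases (inj₂ intP≡intQ) = trans (fAt-zero α β β′ β″ β≡0) (cong +_ (sym Q≡1))
        where
        B≡1 : B ≡ 1ℚ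
        B≡1 = cross-≡⇒frac-≡ (intP n m) (intQ n m) 1 1 (intQ-pos a-pos 1≤n 1≤m) ≤-refl
                (trans (*-identityʳ _) (trans intP≡intQ (sym (*-identityˡ _))))
        β≡0 : IsZero β
        β≡0 = 1≡-mod-1⇒IsZero β k (trans (sym B≡1) B≡β+k)
        Q≡1 : Q (suc n) ≡ 1
        Q≡1 = ≤-antisym (≤-trans (Q≤intQ n m 1≤m) (≤-reflexive (r₁≡r₂⇒r₂≡1 intP≡intQ))) (Q-pos a-pos 1≤n)

    fAt-even : evenB n ≡ true → fAt α β β′ β″ ≡ ℤ.- (+ Q (suc n))
    fAt-even even = fAt-left-endpoint β β′ β″ β≢0 (proj₁ (neighbours β≢0)) (proj₂ (neighbours β≢0))
                      (val≡B l₁<l₂) (Q≤intQ n m 1≤m)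
      where
      straddle = straddle-even 1≤n 1≤m m≤a even
      open Straddling α straddle
      0<B : 0ℚ ℚ.< B
      0<B = cross-<⇒frac-< 0 1 (intP n m) (intQ n m) ≤-refl (intQ-pos a-pos 1≤n 1≤m)
              (subst (0 <_) (sym (*-identityʳ _))
                (≤-trans (P-pos a-pos (even⇒2≤ 1≤n even)) (m≤n*m+o _ m _ 1≤m)))
      β≢0 = B≢0 0<B l₁<l₂

  fAt≡target : ∀ β β′ β″ → (¬ IsZero β → IsPrev β β′ × IsNext β β″) →
               ∀ n → 1 ≤ n → InE a n β → fAt α β β′ β″ ≡ target a n
  fAt≡target β β′ β″ neighbours n 1≤n (m , 1≤m , m≤a , k , B≡β+k) =
    trans (by-parity (evenB n) refl) (sym (target≡signed 1≤n))
    where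
    by-parity : ∀ b → evenB n ≡ b → fAt α β β′ β″ ≡ signed b (Q (suc n))
    by-parity true  even = fAt-even β β′ β″ neighbours k 1≤n 1≤m m≤a B≡β+k even
    by-parity false odd  = fAt-odd β β′ β″ neighbours k 1≤n 1≤m m≤a B≡β+k odd

  fAt≢0⇔InSomeE : ∀ β β′ β″ → (¬ IsZero β → IsPrev β β′ × IsNext β β″) →
                  (fAt α β β′ β″ ≢ + 0) ⇔ InSomeE β
  fAt≢0⇔InSomeE β β′ β″ neighbours = mk⇔ to from
    where
    to : fAt α β β′ β″ ≢ + 0 → InSomeE β
    to f≢0 = by-cases (val β ℚP.≟ 0ℚ)
      where
      by-cases : Dec (IsZero β) → InSomeE β
      by-cases (yes β≡0) = 1 , ≤-refl , zero∈E₁ β β≡0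
      by-cases (no β≢0)  =
        nonvanishing⇒InSomeE β β′ β″ β≢0 (proj₁ (neighbours β≢0)) (proj₂ (neighbours β≢0)) f≢0
    from : InSomeE β → fAt α β β′ β″ ≢ + 0
    from (n , 1≤n , β∈E) f≡0 = signed≢0 (evenB n) (Q (suc n)) (Q-pos a-pos 1≤n)
      (trans (sym (target≡signed 1≤n)) (trans (sym (fAt≡target β β′ β″ neighbours n 1≤n β∈E)) f≡0))

theorem1 : (α : Irr01) (a : ℕ → ℕ) → IsCF α a →
    (β β' β'' : QZ) → (¬ IsZero β → IsPrev β β' × IsNext β β'') →
    ((fAt α β β' β'' ≢ + 0) ⇔ Σ ℕ (λ n → (1 ≤ n) × InE a n β))
    × ((n : ℕ) → 1 ≤ n → InE a n β → fAt α β β' β'' ≡ target a n)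
theorem1 α a cf β β′ β″ neighbours = fAt≢0⇔InSomeE β β′ β″ neighbours , fAt≡target β β′ β″ neighbours
  where open ContinuedFraction α a cf
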